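{- The natural deduction system for $\mathcal{L}_{qd}$ described below is sound: for every set $\Gamma\cup\{\phi\}$ of $\mathcal{L}_{qd}$-formulas, if $\Gamma\vdash\phi$ then $\Gamma\models\phi$.
   Context: Fix a finite set $\mathbb{P}$ of propositional symbols; a valuation is $v:\mathbb{P}\to\{0,1\}$ with $v(\top)=1,v(\bot)=0$; a team is a set of valuations; $\mathbb{F}=2^{\mathbb{P}}$ is the full team. $\mathcal{L}_{qd}$: $\phi::=\bullet\mid\mathsf{p}\subseteq^{\bullet}\mathsf{x}\mid\phi\land\phi\mid\phi\lor\phi\mid\phi\sqcup\phi$, with $\mathsf{p}$ a finite (possibly empty) sequence of symbols of $\mathbb{P}$ and $\mathsf{x}$ a sequence of constants $\top,\bot$, $|\mathsf{p}|=|\mathsf{x}|$. Semantics: $T\models\bullet$ iff $T=\mathbb{F}$; $T\models\mathsf{p}\subseteq^{\bullet}\mathsf{x}$ iff $T=\mathbb{F}$ or for every $v\in T$ there is $v'\in T$ with $v(\mathsf{p})=v'(\mathsf{x})$; $\land$ as usual; $T\models\phi\lor\psi$ iff there are $T_1,T_2\subseteq T$ with $T_1\cup T_2=T$, $T_1\models\phi$, $T_2\models\psi$; $T\models\phi\sqcup\psi$ iff $T\models\phi$ or $T\models\psi$. $\Gamma\models\phi$ iff every team satisfying all of $\Gamma$ satisfies $\phi$. A formula is $\bullet$-free if $\bullet$ does not occur in it, $\sqcup$-free similarly. $\Gamma\vdash\phi$ means a natural deduction derivation of $\phi$ with undischarged assumptions in $\Gamma$ using: ($\bullet$I) from $\phi\lor\bullet$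 infer $\bullet$; ($\bullet$E) from $\bullet$ infer any $\phi$; ($\top$I) infer $\langle\rangle\subseteq^{\bullet}\langle\rangle$ (empty sequences); ($\bot$E) from $q\subseteq^{\bullet}\top$ and $q\subseteq^{\bullet}\bot$ infer $\psi$, provided $\psi$ is $\bullet$-free; ($\bot\lor$E) from $\psi\lor qq\subseteq^{\bullet}\top\bot$ infer $\psi$; ($\subseteq^{\bullet}$Proj) from $\mathsf{p}q\subseteq^{\bullet}\mathsf{x}y$ infer $\mathsf{p}\subseteq^{\bullet}\mathsf{x}$; ($\subseteq^{\bullet}$Perm) from $\mathsf{u}\mathsf{v}\mathsf{w}\subseteq^{\bullet}\mathsf{x}\mathsf{y}\mathsf{z}$ infer $\mathsf{u}\mathsf{w}\mathsf{v}\subseteq^{\bullet}\mathsf{x}\mathsf{z}\mathsf{y}$ provided $|\mathsf{y}|=|\mathsf{v}|$, $|\mathsf{z}|=|\mathsf{w}|$; ($\subseteq^{\bullet}$Ext) from $\mathsf{p}\subseteq^{\bullet}\mathsf{x}$ infer $\mathsf{p}q\subseteq^{\bullet}\mathsf{x}\top\lor\mathsf{p}q\subseteq^{\bullet}\mathsf{x}\bot$; ($\land$I) from $\phi,\psi$ infer $\phi\land\psi$; ($\land$E) from $\phi\land\psi$ infer $\phi$, and $\psi$; ($\sqcup$I) from $\phi$ infer $\phi\sqcup\psi$ and $\psi\sqcup\phi$; ($\sqcup$E) from $\phi\sqcup\psi$ and derivations of $\chi$ from $\phi$ and from $\psi$, infer $\chi$ discharging them; ($\lor$I) from $\phi$ infer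 $\phi\lor\psi$ and $\psi\lor\phi$, provided $\psi$ is $\bullet$-free; ($\lor$E) from $\phi\lor\psi$ and derivations of $\chi$ from $\phi$ and from $\psi$, infer $\chi$ discharging them, provided $\chi$ is $\sqcup$-free; ($\lor$Com) from $\phi\lor\psi$ infer $\psi\lor\phi$; ($\lor$Mon) from $\phi\lor\psi$ and a derivation of $\gamma$ from $\psi$, infer $\phi\lor\gamma$ discharging $\psi$; ($\lor\sqcup$Distr) from $\phi\lor(\psi\sqcup\theta)$ infer $(\phi\lor\psi)\sqcup(\phi\lor\theta)$. -}

module Defs where

open import Data.Nat using (ℕ; zero; suc; _+_)
open import Data.Fin using (Fin)
open import Data.Bool using (Bool; true; false; _∨_)
open import Data.Vec using (Vec; []; _∷_; _++_; [_]; map)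
open import Data.Product using (Σ; _×_; ∃; ∃-syntax)
open import Data.Sum using (_⊎_)
open import Relation.Binary.PropositionalEquality using (_≡_)

-- The finite set ℙ of propositional symbols is Fin n.
-- A valuation assigns a truth value to each symbol; the constants ⊤ and ⊥
-- are represented by the Booleans true and false (so v(⊤)=1, v(⊥)=0).
Valuation : ℕ → Set
Valuation n = Fin n → Bool

-- A team is a set of valuations.  Since 2^ℙ is finite, every team is
-- represented by its (decidable) characteristic function.
Team : ℕ → Set
Team n = Valuation n → Bool

_∈T_ : ∀ {n} → Valuation n → Team n → Set
v ∈T T = T v ≡ true

IsFull : ∀ {n} → Team n → Set
IsFull T = ∀ v → v ∈T T

-- Formulas of L_qd.  incl p x  is  p ⊆• x  with p a sequence of symbols and
-- x a sequence of constants (true = ⊤, false = ⊥) of the same length k.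
infixr 6 _∧'_
infixr 5 _∨'_
infixr 4 _⊔'_
data Formula (n : ℕ) : Set where
  ●    : Formula n
  incl : ∀ {k} → Vec (Fin n) k → Vec Bool k → Formula n
  _∧'_ : Formula n → Formula n → Formula n
  _∨'_ : Formula n → Formula n → Formula n
  _⊔'_ : Formula n → Formula n → Formula n

_⊨_ : ∀ {n} → Team n → Formula n → Set
T ⊨ ● = IsFull T
T ⊨ incl p x = IsFull T ⊎ (∀ v → v ∈T T → ∃[ v' ] (v' ∈T T × map v p ≡ x))
T ⊨ (φ ∧' ψ) = T ⊨ φ × T ⊨ ψ
T ⊨ (φ ∨' ψ) = ∃[ T₁ ] ∃[ T₂ ] ((∀ v → T v ≡ (T₁ v ∨ T₂ v)) × T₁ ⊨ φ × T₂ ⊨ ψ)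
T ⊨ (φ ⊔' ψ) = T ⊨ φ ⊎ T ⊨ ψ

FSet : ℕ → Set₁
FSet n = Formula n → Set

_⊨ˢ_ : ∀ {n} → FSet n → Formula n → Set
Γ ⊨ˢ φ = ∀ (T : Team _) → (∀ ψ → Γ ψ → T ⊨ ψ) → T ⊨ φ

data ●Free {n} : Formula n → Set where
  incl : ∀ {k} (p : Vec (Fin n) k) (x : Vec Bool k) → ●Free (incl p x)
  and  : ∀ {φ ψ} → ●Free φ → ●Free ψ → ●Free (φ ∧' ψ)
  or   : ∀ {φ ψ} → ●Free φ → ●Free ψ → ●Free (φ ∨' ψ)
  sqc  : ∀ {φ ψ} → ●Free φ → ●Free ψ → ●Free (φ ⊔' ψ)

data ⊔Free {n} : Formula n → Set where
  bul  : ⊔Free ●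
  incl : ∀ {k} (p : Vec (Fin n) k) (x : Vec Bool k) → ⊔Free (incl p x)
  and  : ∀ {φ ψ} → ⊔Free φ → ⊔Free ψ → ⊔Free (φ ∧' ψ)
  or   : ∀ {φ ψ} → ⊔Free φ → ⊔Free ψ → ⊔Free (φ ∨' ψ)

⟦_⟧ : ∀ {n} → Formula n → FSet n
⟦ φ ⟧ ψ = ψ ≡ φ

_,,_ : ∀ {n} → FSet n → Formula n → FSet n
(Γ ,, φ) ψ = Γ ψ ⊎ ψ ≡ φ

infix 2 _⊢_
data _⊢_ {n} (Γ : FSet n) : Formula n → Set₁ where
  assum  : ∀ {φ} → Γ φ → Γ ⊢ φ
  ●I     : ∀ {φ} → Γ ⊢ φ ∨' ● → Γ ⊢ ●
  ●E     : ∀ {φ} → Γ ⊢ ● → Γ ⊢ φ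
  ⊤I     : Γ ⊢ incl [] []
  ⊥E     : ∀ {q ψ} → ●Free ψ →
           Γ ⊢ incl [ q ] [ true ] → Γ ⊢ incl [ q ] [ false ] → Γ ⊢ ψ
  ⊥∨E    : ∀ {q ψ} → Γ ⊢ ψ ∨' incl (q ∷ q ∷ []) (true ∷ false ∷ []) → Γ ⊢ ψ
  ⊆Proj  : ∀ {k} {p : Vec (Fin n) k} {x : Vec Bool k} {q y} →
           Γ ⊢ incl (p ++ [ q ]) (x ++ [ y ]) → Γ ⊢ incl p x
  ⊆Perm  : ∀ {a b c} {u : Vec (Fin n) a} {v : Vec (Fin n) b} {w : Vec (Fin n) c}
             {x : Vec Bool a} {y : Vec Bool b} {z : Vec Bool c} →
           Γ ⊢ incl (u ++ v ++ w) (x ++ y ++ z) → Γ ⊢ incl (u ++ w ++ v) (x ++ z ++ y)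
  ⊆Ext   : ∀ {k} {p : Vec (Fin n) k} {x : Vec Bool k} {q} →
           Γ ⊢ incl p x →
           Γ ⊢ incl (p ++ [ q ]) (x ++ [ true ]) ∨' incl (p ++ [ q ]) (x ++ [ false ])
  ∧I     : ∀ {φ ψ} → Γ ⊢ φ → Γ ⊢ ψ → Γ ⊢ φ ∧' ψ
  ∧E₁    : ∀ {φ ψ} → Γ ⊢ φ ∧' ψ → Γ ⊢ φ
  ∧E₂    : ∀ {φ ψ} → Γ ⊢ φ ∧' ψ → Γ ⊢ ψ
  ⊔I₁    : ∀ {φ ψ} → Γ ⊢ φ → Γ ⊢ φ ⊔' ψ
  ⊔I₂    : ∀ {φ ψ} → Γ ⊢ φ → Γ ⊢ ψ ⊔' φ
  ⊔E     : ∀ {φ ψ χ} → Γ ⊢ φ ⊔' ψ → (Γ ,, φ) ⊢ χ → (Γ ,, ψ) ⊢ χ → Γ ⊢ χ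
  ∨I₁    : ∀ {φ ψ} → ●Free ψ → Γ ⊢ φ → Γ ⊢ φ ∨' ψ
  ∨I₂    : ∀ {φ ψ} → ●Free ψ → Γ ⊢ φ → Γ ⊢ ψ ∨' φ
  ∨E     : ∀ {φ ψ χ} → ⊔Free χ → Γ ⊢ φ ∨' ψ → ⟦ φ ⟧ ⊢ χ → ⟦ ψ ⟧ ⊢ χ → Γ ⊢ χ
  ∨Com   : ∀ {φ ψ} → Γ ⊢ φ ∨' ψ → Γ ⊢ ψ ∨' φ
  ∨Mon   : ∀ {φ ψ γ} → Γ ⊢ φ ∨' ψ → ⟦ ψ ⟧ ⊢ γ → Γ ⊢ φ ∨' γ
  ∨⊔Distr : ∀ {φ ψ θ} → Γ ⊢ φ ∨' (ψ ⊔' θ) → Γ ⊢ (φ ∨' ψ) ⊔' (φ ∨' θ)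

-- Four semantic facts carry all the rules.  The full team satisfies
-- every formula and the empty team every •-free formula.  The ⊔-free formulas
-- are closed under unions of teams.  Finally, because x consists of constants,
-- the witness v' in the semantics of p ⊆• x can always be v itself, so a
-- non-full team satisfies p ⊆• x iff all of its valuations map p to x; this
-- makes the rules ⊆•Proj, ⊆•Perm, ⊆•Ext, ⊥E and ⊥∨E statements about vectors
-- of truth values.
module Submission where

open import Defs
open import Data.Nat using (ℕ)
open import Data.Fin using (Fin)
open import Data.Bool using (Bool; true; false; not; _∨_; _∧_)
open import Data.Bool.Properties
  using (∨-idem; ∨-comm; ∨-zeroʳ; ∨-identityʳ; ∨-inverseʳ; ∨-sel; ∨-commutativeMonoid;
         ∧-distribˡ-∨; ∧-identityʳ; ∧-conicalˡ; ∧-conicalʳ; not-injective; ¬-not)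
open import Algebra.Bundles using (CommutativeMonoid)
open import Algebra.Properties.CommutativeSemigroup
  (CommutativeMonoid.commutativeSemigroup ∨-commutativeMonoid) using (interchange)
open import Data.Vec using (Vec; []; _∷_; _++_; [_]; map)
open import Data.Vec.Properties using (map-++; ++-injective; ∷-injectiveˡ; ∷-injectiveʳ)
open import Data.Empty using (⊥-elim)
open import Data.Product using (_×_; _,_; proj₁; proj₂)
open import Data.Sum using (_⊎_; inj₁; inj₂; [_,_]′)
open import Function using (_∘_)
open import Relation.Nullary using (¬_)
open import Relation.Binary.PropositionalEquality
  using (_≡_; _≗_; refl; sym; trans; cong; cong₂; module ≡-Reasoning)

private
  variable
    n k l m : ℕ
    A B : Set

module _ {f : A → B} where

  map-++⁺ : {u : Vec A k} {w : Vec A l} {x : Vec B k} {y : Vec B l} →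
            map f u ≡ x → map f w ≡ y → map f (u ++ w) ≡ x ++ y
  map-++⁺ {u = u} {w} fu≡x fw≡y = trans (map-++ f u w) (cong₂ _++_ fu≡x fw≡y)

  map-++⁻ : (u : Vec A k) {w : Vec A l} {x : Vec B k} {y : Vec B l} →
            map f (u ++ w) ≡ x ++ y → map f u ≡ x × map f w ≡ y
  map-++⁻ u {w} {x} eq = ++-injective (map f u) x (trans (sym (map-++ f u w)) eq)

  map-++-swap : (u : Vec A k) (v : Vec A l) {w : Vec A m}
                {x : Vec B k} {y : Vec B l} {z : Vec B m} →
                map f (u ++ v ++ w) ≡ x ++ y ++ z → map f (u ++ w ++ v) ≡ x ++ z ++ y
  map-++-swap u v {x = x} {y} eq =
    let fu , fvw = map-++⁻ u {x = x} eq
        fv , fw  = map-++⁻ v {x = y} fvw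
    in map-++⁺ fu (map-++⁺ fw fv)

private
  variable
    T T' T₁ T₂ : Team n
    φ ψ χ γ : Formula n
    Γ : FSet n
    q : Fin n
    p p' : Vec (Fin n) k
    x x' : Vec Bool k

_∪_ : Team n → Team n → Team n
(T₁ ∪ T₂) v = T₁ v ∨ T₂ v

∅ : Team n
∅ _ = false

filter : (Valuation n → Bool) → Team n → Team n
filter P T v = T v ∧ P v

_⊆ᵀ_ : Team n → Team n → Set
T ⊆ᵀ T' = ∀ v → v ∈T T → v ∈T T'

Empty : Team n → Set
Empty T = ∀ v → ¬ v ∈T T

IsFull-resp-≗ : T ≗ T' → IsFull T → IsFull T'
IsFull-resp-≗ T≗T' full v = trans (sym (T≗T' v)) (full v)

∪-fullˡ : IsFull T₁ → IsFull (T₁ ∪ T₂)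
∪-fullˡ {T₂ = T₂} full v = cong (_∨ T₂ v) (full v)

∪-fullʳ : IsFull T₂ → IsFull (T₁ ∪ T₂)
∪-fullʳ {T₁ = T₁} full v = trans (cong (T₁ v ∨_) (full v)) (∨-zeroʳ (T₁ v))

∈-∪⁻ : ∀ {v} → v ∈T (T₁ ∪ T₂) → v ∈T T₁ ⊎ v ∈T T₂
∈-∪⁻ {T₁ = T₁} {T₂} {v} v∈ with ∨-sel (T₁ v) (T₂ v)
... | inj₁ eq = inj₁ (trans (sym eq) v∈)
... | inj₂ eq = inj₂ (trans (sym eq) v∈)

∪-idem : T ∪ T ≗ T
∪-idem {T = T} v = ∨-idem (T v)

∪-emptyʳ : Empty T₂ → T₁ ∪ T₂ ≗ T₁
∪-emptyʳ {T₁ = T₁} empty v = trans (cong (T₁ v ∨_) (¬-not (empty v))) (∨-identityʳ (T₁ v))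

split-fullʳ : T ≗ T₁ ∪ T₂ → IsFull T₂ → IsFull T
split-fullʳ T≗ full₂ = IsFull-resp-≗ (sym ∘ T≗) (∪-fullʳ full₂)

split-emptyʳ : T ≗ T₁ ∪ T₂ → Empty T₂ → T₁ ≗ T
split-emptyʳ {T₁ = T₁} T≗ empty v = sym (trans (T≗ v) (∪-emptyʳ {T₁ = T₁} empty v))

filter-⊆ : ∀ {P} → filter P T ⊆ᵀ T
filter-⊆ {T = T} {P} v = ∧-conicalˡ (T v) (P v)

filter-split : ∀ P → T ≗ filter P T ∪ filter (not ∘ P) T
filter-split {T = T} P v = sym (begin
  T v ∧ P v ∨ T v ∧ not (P v)  ≡⟨ ∧-distribˡ-∨ (T v) (P v) (not (P v)) ⟨
  T v ∧ (P v ∨ not (P v))      ≡⟨ cong (T v ∧_) (∨-inverseʳ (P v)) ⟩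
  T v ∧ true                   ≡⟨ ∧-identityʳ (T v) ⟩
  T v                          ∎)
  where open ≡-Reasoning

Uniform : Team n → Vec (Fin n) k → Vec Bool k → Set
Uniform T p x = ∀ v → v ∈T T → map v p ≡ x

uniform-⊆ : T' ⊆ᵀ T → Uniform T p x → Uniform T' p x
uniform-⊆ T'⊆T u v v∈T' = u v (T'⊆T v v∈T')

uniform-++ : Uniform T p x → Uniform T p' x' → Uniform T (p ++ p') (x ++ x')
uniform-++ u u' v v∈T = map-++⁺ (u v v∈T) (u' v v∈T)

uniform-∪ : Uniform T₁ p x → Uniform T₂ p x → Uniform (T₁ ∪ T₂) p x
uniform-∪ {T₁ = T₁} {T₂ = T₂} u₁ u₂ v v∈ = [ u₁ v , u₂ v ]′ (∈-∪⁻ {T₁ = T₁} {T₂} v∈)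

filter-uniform : Uniform (filter (λ v → v q) T) [ q ] [ true ]
filter-uniform {q = q} {T = T} v v∈ = cong [_] (∧-conicalʳ (T v) (v q) v∈)

filter-not-uniform : Uniform (filter (λ v → not (v q)) T) [ q ] [ false ]
filter-not-uniform {q = q} {T = T} v v∈ =
  cong [_] (not-injective (∧-conicalʳ (T v) (not (v q)) v∈))

contradictory-uniform⇒empty : Uniform T (q ∷ q ∷ []) (true ∷ false ∷ []) → Empty T
contradictory-uniform⇒empty u v v∈T with () ←
  trans (sym (∷-injectiveˡ (u v v∈T))) (∷-injectiveˡ (∷-injectiveʳ (u v v∈T)))

⊨incl⇒full⊎uniform : T ⊨ incl p x → IsFull T ⊎ Uniform T p x
⊨incl⇒full⊎uniform (inj₁ full) = inj₁ full
⊨incl⇒full⊎uniform (inj₂ inc) = inj₂ λ v v∈T → proj₂ (proj₂ (inc v v∈T))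

uniform⇒⊨incl : Uniform T p x → T ⊨ incl p x
uniform⇒⊨incl u = inj₂ λ v v∈T → v , v∈T , u v v∈T

⊨incl-mono : (∀ (v : Valuation n) → map v p ≡ x → map v p' ≡ x') →
             T ⊨ incl p x → T ⊨ incl p' x'
⊨incl-mono _ (inj₁ full) = inj₁ full
⊨incl-mono mono (inj₂ inc) = inj₂ λ v v∈T →
  let v' , v'∈T , eq = inc v v∈T in v' , v'∈T , mono v eq

⊨-resp-≗ : T ≗ T' → T ⊨ φ → T' ⊨ φ
⊨-resp-≗ {φ = ●} T≗T' full = IsFull-resp-≗ T≗T' full
⊨-resp-≗ {φ = incl p x} T≗T' (inj₁ full) = inj₁ (IsFull-resp-≗ T≗T' full)
⊨-resp-≗ {φ = incl p x} T≗T' (inj₂ inc) = inj₂ λ v v∈T' →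
  let v' , v'∈T , eq = inc v (trans (T≗T' v) v∈T')
  in v' , trans (sym (T≗T' v')) v'∈T , eq
⊨-resp-≗ {φ = φ ∧' ψ} T≗T' (⊨φ , ⊨ψ) = ⊨-resp-≗ T≗T' ⊨φ , ⊨-resp-≗ T≗T' ⊨ψ
⊨-resp-≗ {φ = φ ∨' ψ} T≗T' (T₁ , T₂ , T≗ , ⊨φ , ⊨ψ) =
  T₁ , T₂ , (λ v → trans (sym (T≗T' v)) (T≗ v)) , ⊨φ , ⊨ψ
⊨-resp-≗ {φ = φ ⊔' ψ} T≗T' (inj₁ ⊨φ) = inj₁ (⊨-resp-≗ T≗T' ⊨φ)
⊨-resp-≗ {φ = φ ⊔' ψ} T≗T' (inj₂ ⊨ψ) = inj₂ (⊨-resp-≗ T≗T' ⊨ψ)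

⊨∨-self : T ⊨ φ → T ⊨ ψ → T ⊨ (φ ∨' ψ)
⊨∨-self {T = T} ⊨φ ⊨ψ = T , T , sym ∘ ∪-idem , ⊨φ , ⊨ψ

⊨-full : IsFull T → T ⊨ φ
⊨-full {φ = ●} full = full
⊨-full {φ = incl p x} full = inj₁ full
⊨-full {φ = φ ∧' ψ} full = ⊨-full full , ⊨-full full
⊨-full {φ = φ ∨' ψ} full = ⊨∨-self (⊨-full full) (⊨-full full)
⊨-full {φ = φ ⊔' ψ} full = inj₁ (⊨-full full)

⊨-empty : ●Free φ → Empty T → T ⊨ φ
⊨-empty (incl p x) empty = uniform⇒⊨incl λ v v∈T → ⊥-elim (empty v v∈T)
⊨-empty (and fφ fψ) empty = ⊨-empty fφ empty , ⊨-empty fψ empty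
⊨-empty (or fφ fψ) empty = ⊨∨-self (⊨-empty fφ empty) (⊨-empty fψ empty)
⊨-empty (sqc fφ fψ) empty = inj₁ (⊨-empty fφ empty)

⊨-∪ : ⊔Free φ → T₁ ⊨ φ → T₂ ⊨ φ → (T₁ ∪ T₂) ⊨ φ
⊨-∪ bul full₁ _ = ∪-fullˡ full₁
⊨-∪ (incl p x) ⊨₁ ⊨₂ with ⊨incl⇒full⊎uniform ⊨₁ | ⊨incl⇒full⊎uniform ⊨₂
... | inj₁ full₁ | _          = inj₁ (∪-fullˡ full₁)
... | inj₂ _     | inj₁ full₂ = inj₁ (∪-fullʳ full₂)
... | inj₂ u₁    | inj₂ u₂    = uniform⇒⊨incl (uniform-∪ u₁ u₂)
⊨-∪ (and fφ fψ) (⊨φ₁ , ⊨ψ₁) (⊨φ₂ , ⊨ψ₂) = ⊨-∪ fφ ⊨φ₁ ⊨φ₂ , ⊨-∪ fψ ⊨ψ₁ ⊨ψ₂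
⊨-∪ (or fφ fψ) (A₁ , A₂ , T₁≗ , ⊨φ₁ , ⊨ψ₁) (B₁ , B₂ , T₂≗ , ⊨φ₂ , ⊨ψ₂) =
  A₁ ∪ B₁ , A₂ ∪ B₂ ,
  (λ v → trans (cong₂ _∨_ (T₁≗ v) (T₂≗ v)) (interchange (A₁ v) (A₂ v) (B₁ v) (B₂ v))) ,
  ⊨-∪ fφ ⊨φ₁ ⊨φ₂ , ⊨-∪ fψ ⊨ψ₁ ⊨ψ₂

_⊨ᶜ_ : Team n → FSet n → Set
T ⊨ᶜ Γ = ∀ ψ → Γ ψ → T ⊨ ψ

⊨ᶜ-⟦⟧ : T ⊨ φ → T ⊨ᶜ ⟦ φ ⟧
⊨ᶜ-⟦⟧ ⊨φ _ refl = ⊨φ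

⊨ᶜ-,, : T ⊨ᶜ Γ → T ⊨ φ → T ⊨ᶜ (Γ ,, φ)
⊨ᶜ-,, ⊨Γ _  _ (inj₁ γ)    = ⊨Γ _ γ
⊨ᶜ-,, _  ⊨φ _ (inj₂ refl) = ⊨φ

●I-sound : T ⊨ (φ ∨' ●) → IsFull T
●I-sound (_ , _ , T≗ , _ , full₂) = split-fullʳ T≗ full₂

⊥E-sound : ●Free ψ → T ⊨ incl [ q ] [ true ] → T ⊨ incl [ q ] [ false ] → T ⊨ ψ
⊥E-sound free ⊨q⊤ ⊨q⊥ with ⊨incl⇒full⊎uniform ⊨q⊤ | ⊨incl⇒full⊎uniform ⊨q⊥
... | inj₁ full | _         = ⊨-full full
... | inj₂ _    | inj₁ full = ⊨-full full
... | inj₂ u⊤   | inj₂ u⊥   = ⊨-empty free (contradictory-uniform⇒empty (uniform-++ u⊤ u⊥))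

⊥∨E-sound : T ⊨ (ψ ∨' incl (q ∷ q ∷ []) (true ∷ false ∷ [])) → T ⊨ ψ
⊥∨E-sound (T₁ , T₂ , T≗ , ⊨ψ , ⊨qq) with ⊨incl⇒full⊎uniform ⊨qq
... | inj₁ full₂ = ⊨-full (split-fullʳ T≗ full₂)
... | inj₂ u     = ⊨-resp-≗ (split-emptyʳ T≗ (contradictory-uniform⇒empty {T = T₂} u)) ⊨ψ

⊆Proj-sound : ∀ {y} → T ⊨ incl (p ++ [ q ]) (x ++ [ y ]) → T ⊨ incl p x
⊆Proj-sound {p = p} {x = x} = ⊨incl-mono λ v → proj₁ ∘ map-++⁻ p {x = x}

⊆Perm-sound : (u : Vec (Fin n) k) (v : Vec (Fin n) l) {w : Vec (Fin n) m}
              (x : Vec Bool k) (y : Vec Bool l) {z : Vec Bool m} →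
              T ⊨ incl (u ++ v ++ w) (x ++ y ++ z) → T ⊨ incl (u ++ w ++ v) (x ++ z ++ y)
⊆Perm-sound u v x y = ⊨incl-mono λ _ → map-++-swap u v {x = x} {y}

uniform⇒⊨split : Uniform T p x → ∀ q →
                 T ⊨ (incl (p ++ [ q ]) (x ++ [ true ]) ∨' incl (p ++ [ q ]) (x ++ [ false ]))
uniform⇒⊨split {T = T} u q =
  filter (λ v → v q) T , filter (λ v → not (v q)) T , filter-split (λ v → v q) ,
  uniform⇒⊨incl (uniform-++ (uniform-⊆ filter-⊆ u) filter-uniform) ,
  uniform⇒⊨incl (uniform-++ (uniform-⊆ filter-⊆ u) filter-not-uniform)

⊆Ext-sound : ∀ q → T ⊨ incl p x →
             T ⊨ (incl (p ++ [ q ]) (x ++ [ true ]) ∨' incl (p ++ [ q ]) (x ++ [ false ]))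
⊆Ext-sound q ⊨px =
  [ ⊨-full {φ = incl _ _ ∨' incl _ _} , (λ u → uniform⇒⊨split u q) ]′ (⊨incl⇒full⊎uniform ⊨px)

⊔E-sound : (Γ ,, φ) ⊨ˢ χ → (Γ ,, ψ) ⊨ˢ χ → T ⊨ᶜ Γ → T ⊨ (φ ⊔' ψ) → T ⊨ χ
⊔E-sound {T = T} φ⊨χ ψ⊨χ ⊨Γ =
  [ (λ ⊨φ → φ⊨χ T (⊨ᶜ-,, ⊨Γ ⊨φ)) , (λ ⊨ψ → ψ⊨χ T (⊨ᶜ-,, ⊨Γ ⊨ψ)) ]′

∨I₁-sound : ●Free ψ → T ⊨ φ → T ⊨ (φ ∨' ψ)
∨I₁-sound {T = T} free ⊨φ = T , ∅ , (λ v → sym (∨-identityʳ (T v))) , ⊨φ , ⊨-empty free λ _ ()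

∨I₂-sound : ●Free ψ → T ⊨ φ → T ⊨ (ψ ∨' φ)
∨I₂-sound {T = T} free ⊨φ = ∅ , T , (λ _ → refl) , ⊨-empty free (λ _ ()) , ⊨φ

∨E-sound : ⊔Free χ → ⟦ φ ⟧ ⊨ˢ χ → ⟦ ψ ⟧ ⊨ˢ χ → T ⊨ (φ ∨' ψ) → T ⊨ χ
∨E-sound free φ⊨χ ψ⊨χ (T₁ , T₂ , T≗ , ⊨φ , ⊨ψ) =
  ⊨-resp-≗ (sym ∘ T≗) (⊨-∪ free (φ⊨χ T₁ (⊨ᶜ-⟦⟧ ⊨φ)) (ψ⊨χ T₂ (⊨ᶜ-⟦⟧ ⊨ψ)))

∨Com-sound : T ⊨ (φ ∨' ψ) → T ⊨ (ψ ∨' φ)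
∨Com-sound (T₁ , T₂ , T≗ , ⊨φ , ⊨ψ) =
  T₂ , T₁ , (λ v → trans (T≗ v) (∨-comm (T₁ v) (T₂ v))) , ⊨ψ , ⊨φ

∨Mon-sound : ⟦ ψ ⟧ ⊨ˢ γ → T ⊨ (φ ∨' ψ) → T ⊨ (φ ∨' γ)
∨Mon-sound ψ⊨γ (T₁ , T₂ , T≗ , ⊨φ , ⊨ψ) = T₁ , T₂ , T≗ , ⊨φ , ψ⊨γ T₂ (⊨ᶜ-⟦⟧ ⊨ψ)

∨⊔Distr-sound : T ⊨ (φ ∨' (ψ ⊔' χ)) → T ⊨ ((φ ∨' ψ) ⊔' (φ ∨' χ))
∨⊔Distr-sound (T₁ , T₂ , T≗ , ⊨φ , inj₁ ⊨ψ) = inj₁ (T₁ , T₂ , T≗ , ⊨φ , ⊨ψ)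
∨⊔Distr-sound (T₁ , T₂ , T≗ , ⊨φ , inj₂ ⊨χ) = inj₂ (T₁ , T₂ , T≗ , ⊨φ , ⊨χ)

soundness : Γ ⊢ φ → Γ ⊨ˢ φ
soundness (assum γ)         T ⊨Γ = ⊨Γ _ γ
soundness (●I d)            T ⊨Γ = ●I-sound (soundness d T ⊨Γ)
soundness (●E d)            T ⊨Γ = ⊨-full (soundness d T ⊨Γ)
soundness ⊤I                T ⊨Γ = uniform⇒⊨incl λ _ _ → refl
soundness (⊥E free d₁ d₂)   T ⊨Γ = ⊥E-sound free (soundness d₁ T ⊨Γ) (soundness d₂ T ⊨Γ)
soundness (⊥∨E d)           T ⊨Γ = ⊥∨E-sound (soundness d T ⊨Γ)
soundness (⊆Proj d)         T ⊨Γ = ⊆Proj-sound (soundness d T ⊨Γ)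
soundness (⊆Perm {u = u} {v} {x = x} {y} d) T ⊨Γ = ⊆Perm-sound u v x y (soundness d T ⊨Γ)
soundness (⊆Ext {q = q} d)  T ⊨Γ = ⊆Ext-sound q (soundness d T ⊨Γ)
soundness (∧I d₁ d₂)        T ⊨Γ = soundness d₁ T ⊨Γ , soundness d₂ T ⊨Γ
soundness (∧E₁ d)           T ⊨Γ = proj₁ (soundness d T ⊨Γ)
soundness (∧E₂ d)           T ⊨Γ = proj₂ (soundness d T ⊨Γ)
soundness (⊔I₁ d)           T ⊨Γ = inj₁ (soundness d T ⊨Γ)
soundness (⊔I₂ d)           T ⊨Γ = inj₂ (soundness d T ⊨Γ)
soundness (⊔E d d₁ d₂)      T ⊨Γ = ⊔E-sound (soundness d₁) (soundness d₂) ⊨Γ (soundness d T ⊨Γ)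
soundness (∨I₁ free d)      T ⊨Γ = ∨I₁-sound free (soundness d T ⊨Γ)
soundness (∨I₂ free d)      T ⊨Γ = ∨I₂-sound free (soundness d T ⊨Γ)
soundness (∨E free d d₁ d₂) T ⊨Γ = ∨E-sound free (soundness d₁) (soundness d₂) (soundness d T ⊨Γ)
soundness (∨Com d)          T ⊨Γ = ∨Com-sound (soundness d T ⊨Γ)
soundness (∨Mon d d₁)       T ⊨Γ = ∨Mon-sound (soundness d₁) (soundness d T ⊨Γ)
soundness (∨⊔Distr d)       T ⊨Γ = ∨⊔Distr-sound (soundness d T ⊨Γ)

mainTheorem14 : ∀ {n : ℕ} (Γ : FSet n) (φ : Formula n) → Γ ⊢ φ → Γ ⊨ˢ φ
mainTheorem14 Γ φ = soundness
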